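{- Let $G$ be a subgraph of $Q_n$ with average degree $d$. For each vertex $v$ of $G$, let $|L_G(v)|$ denote the maximum length of an increasing geodesic in $G$ ending at $v$. Then $$\sum_{v\in V(G)} |L_G(v)| \ge d\,|G|.$$
   Context: The hypercube $Q_n$ has vertex set $\{0,1\}^n$, two vertices being adjacent if they differ in exactly one coordinate; the direction of an edge is that coordinate in $\{1,\dots,n\}$. A path $P=x_1x_2\ldots x_l$ in $Q_n$ is an increasing geodesic if the directions of the edges $x_ix_{i+1}$ are strictly increasing in $i$; it ends at $x$ if $x=x_l$. The length of a path is its number of edges (a single vertex is an increasing geodesic of length $0$ ending at itself). $|G|$ denotes the number of vertices of $G$. -}

module Defs where

open import Data.Bool using (Bool; true; false; not)
open import Data.Nat using (ℕ; zero; suc; _<_)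
open import Data.Fin using (Fin; toℕ)
open import Data.Vec using (Vec; []; _∷_; _[_]%=_)
open import Data.List using (List; []; _∷_; map; _++_; length; filter; allFin)
open import Relation.Binary.PropositionalEquality using (_≡_)
open import Relation.Nullary.Decidable using (does)
open import Data.Bool.Properties using (T?)

Vert : ℕ → Set
Vert n = Vec Bool n

flipAt : ∀ {n} → Fin n → Vert n → Vert n
flipAt i x = x [ i ]%= not

allVerts : (n : ℕ) → List (Vert n)
allVerts zero = [] ∷ []
allVerts (suc n) = map (false ∷_) (allVerts n) ++ map (true ∷_) (allVerts n)

-- A subgraph G of Q_n: a vertex set and an edge set.
-- inE x i = true  means the edge {x, flipAt i x} (of direction i) lies in G.
record Subgraph (n : ℕ) : Set where
  field
    inV      : Vert n → Bool
    inE      : Vert n → Fin n → Bool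
    edge-sym : ∀ x i → inE (flipAt i x) i ≡ inE x i
    edge-V   : ∀ x i → inE x i ≡ true → inV x ≡ true
open Subgraph public

verticesOf : ∀ {n} → Subgraph n → List (Vert n)
verticesOf {n} G = filter (λ x → T? (inV G x)) (allVerts n)

degree : ∀ {n} → Subgraph n → Vert n → ℕ
degree {n} G v = length (filter (λ i → T? (inE G v i)) (allFin n))

-- IncGeo G v l b : there is an increasing geodesic x_1 ... x_{l+1} in G
-- ending at v, of length l, all of whose edge directions are < b.
data IncGeo {n : ℕ} (G : Subgraph n) : Vert n → ℕ → ℕ → Set where
  single : ∀ {v b} → inV G v ≡ true → IncGeo G v 0 b
  extend : ∀ {u l b} (i : Fin n) → IncGeo G u l (toℕ i) → inE G u i ≡ true →
           toℕ i < b → IncGeo G (flipAt i u) (suc l) b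

IncGeoEndingAt : ∀ {n} → Subgraph n → Vert n → ℕ → Set
IncGeoEndingAt {n} G v l = IncGeo G v l n

IsMaxIncLen : ∀ {n} → Subgraph n → Vert n → ℕ → Set
IsMaxIncLen G v m = IncGeoEndingAt G v m × (∀ l → IncGeoEndingAt G v l → l Data.Nat.≤ m)
  where open import Data.Product using (_×_)

-- Label every vertex by the length of an increasing geodesic ending there, starting from 0 and
-- processing the directions 1, …, n in increasing order: relaxing along all edges uv of direction
-- i replaces the label of v by max(m v, m u + 1), and symmetrically for u. Since
-- max(a, b + 1) + max(b, a + 1) ≥ a + b + 2, the total label grows by at least 2 per edge of
-- direction i, so at the end it is at least 2|E(G)| = d|G|; and each final label is the length
-- of an actual increasing geodesic, hence at most |L_G(v)|.
module Submission where

open import Defs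
open import Data.Nat using (ℕ; zero; suc; _+_; _≤_; _<_; _⊔_; z≤n; s≤s)
open import Data.Nat.Properties
open import Data.Nat.ListAction using (sum)
open import Data.Nat.ListAction.Properties using (sum-++)
open import Algebra.Properties.CommutativeSemigroup +-commutativeSemigroup using (interchange)
open import Data.Bool using (Bool; true; false; if_then_else_)
open import Data.Bool.Properties using (T?; not-involutive)
open import Data.Fin using (Fin; toℕ) renaming (zero to fzero; suc to fsuc)
open import Data.Vec using (_∷_)
open import Data.Vec.Properties using (updateAt-updateAt-local; updateAt-id)
open import Data.List using (List; []; _∷_; _++_; map; filter; foldl; allFin; length; tabulate)
open import Data.List.Properties using (map-++; map-∘; map-cong)
open import Data.Product using (proj₂)
open import Data.Sum using (inj₁; inj₂)
open import Relation.Binary.PropositionalEquality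
  using (_≡_; refl; sym; trans; cong; cong₂; subst; module ≡-Reasoning)
open import Function using (_∘_; id)

private
  variable
    A B : Set

sum-map-++ : (f : A → ℕ) (xs ys : List A) →
  sum (map f (xs ++ ys)) ≡ sum (map f xs) + sum (map f ys)
sum-map-++ f xs ys = trans (cong sum (map-++ f xs ys)) (sum-++ (map f xs) (map f ys))

sum-map-∘ : (f : B → ℕ) (g : A → B) (xs : List A) →
  sum (map f (map g xs)) ≡ sum (map (f ∘ g) xs)
sum-map-∘ f g xs = cong sum (sym (map-∘ xs))

sum-map-+ : (f g : A → ℕ) (xs : List A) →
  sum (map (λ x → f x + g x) xs) ≡ sum (map f xs) + sum (map g xs)
sum-map-+ f g [] = refl
sum-map-+ f g (x ∷ xs) = trans (cong (f x + g x +_) (sum-map-+ f g xs))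
                               (interchange (f x) (g x) (sum (map f xs)) (sum (map g xs)))

sum-map-mono : {f g : A → ℕ} → (∀ x → f x ≤ g x) → (xs : List A) →
  sum (map f xs) ≤ sum (map g xs)
sum-map-mono f≤g [] = z≤n
sum-map-mono f≤g (x ∷ xs) = +-mono-≤ (f≤g x) (sum-map-mono f≤g xs)

sum-map-swap : (F : A → B → ℕ) (xs : List A) (ys : List B) →
  sum (map (λ x → sum (map (F x) ys)) xs) ≡ sum (map (λ y → sum (map (λ x → F x y) xs)) ys)
sum-map-swap F [] ys = sym (sum-map-zero ys)
  where
  sum-map-zero : (ys : List B) → sum (map (λ _ → 0) ys) ≡ 0
  sum-map-zero [] = refl
  sum-map-zero (_ ∷ ys) = sum-map-zero ys
sum-map-swap F (x ∷ xs) ys =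
  trans (cong (sum (map (F x) ys) +_) (sum-map-swap F xs ys))
        (sym (sum-map-+ (F x) (λ y → sum (map (λ x → F x y) xs)) ys))

sum-map-filter : (p : A → Bool) (f : A → ℕ) (xs : List A) →
  sum (map f (filter (T? ∘ p) xs)) ≡ sum (map (λ x → if p x then f x else 0) xs)
sum-map-filter p f [] = refl
sum-map-filter p f (x ∷ xs) with p x
... | true = cong (f x +_) (sum-map-filter p f xs)
... | false = sum-map-filter p f xs

length-filter : (p : A → Bool) (xs : List A) →
  length (filter (T? ∘ p) xs) ≡ sum (map (λ x → if p x then 1 else 0) xs)
length-filter p [] = refl
length-filter p (x ∷ xs) with p x
... | true = cong suc (length-filter p xs)
... | false = length-filter p xs

m+m≤n+n⇒m≤n : ∀ {m n} → m + m ≤ n + n → m ≤ n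
m+m≤n+n⇒m≤n m+m≤n+n = ≮⇒≥ λ n<m → <⇒≱ (+-mono-< n<m n<m) m+m≤n+n

suc-+-suc≤⊔-+-⊔ : ∀ a b → suc a + suc b ≤ (a ⊔ suc b) + (b ⊔ suc a)
suc-+-suc≤⊔-+-⊔ a b = ≤-trans (≤-reflexive (+-comm (suc a) (suc b)))
                              (+-mono-≤ (m≤n⊔m a (suc b)) (m≤n⊔m b (suc a)))

flipAt-involutive : ∀ {n} (i : Fin n) (x : Vert n) → flipAt i (flipAt i x) ≡ x
flipAt-involutive i x = trans (updateAt-updateAt-local i x (not-involutive _)) (updateAt-id i x)

sumQ : ∀ {n} → (Vert n → ℕ) → ℕ
sumQ {n} f = sum (map f (allVerts n))

sumQ-suc : ∀ {n} (f : Vert (suc n) → ℕ) → sumQ f ≡ sumQ (f ∘ (false ∷_)) + sumQ (f ∘ (true ∷_))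
sumQ-suc {n} f =
  trans (sum-map-++ f (map (false ∷_) (allVerts n)) (map (true ∷_) (allVerts n)))
        (cong₂ _+_ (sum-map-∘ f (false ∷_) (allVerts n)) (sum-map-∘ f (true ∷_) (allVerts n)))

sumQ-flipAt : ∀ {n} (i : Fin n) (f : Vert n → ℕ) → sumQ (f ∘ flipAt i) ≡ sumQ f
sumQ-flipAt fzero f = begin
  sumQ (f ∘ flipAt fzero)                       ≡⟨ sumQ-suc (f ∘ flipAt fzero) ⟩
  sumQ (f ∘ (true ∷_)) + sumQ (f ∘ (false ∷_))  ≡⟨ +-comm (sumQ (f ∘ (true ∷_))) _ ⟩
  sumQ (f ∘ (false ∷_)) + sumQ (f ∘ (true ∷_))  ≡⟨ sym (sumQ-suc f) ⟩
  sumQ f                                        ∎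
  where open ≡-Reasoning
sumQ-flipAt (fsuc i) f = begin
  sumQ (f ∘ flipAt (fsuc i))                    ≡⟨ sumQ-suc (f ∘ flipAt (fsuc i)) ⟩
  sumQ (f ∘ (false ∷_) ∘ flipAt i) + sumQ (f ∘ (true ∷_) ∘ flipAt i)
    ≡⟨ cong₂ _+_ (sumQ-flipAt i (f ∘ (false ∷_))) (sumQ-flipAt i (f ∘ (true ∷_))) ⟩
  sumQ (f ∘ (false ∷_)) + sumQ (f ∘ (true ∷_))  ≡⟨ sym (sumQ-suc f) ⟩
  sumQ f                                        ∎
  where open ≡-Reasoning

module _ {n} {G : Subgraph n} where

  IncGeo-weaken : ∀ {v l b b′} → b ≤ b′ → IncGeo G v l b → IncGeo G v l b′
  IncGeo-weaken _ (single v∈G) = single v∈G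
  IncGeo-weaken b≤b′ (extend i γ e i<b) = extend i γ e (≤-trans i<b b≤b′)

  IncGeo-⊔ : ∀ {v l l′ b} → IncGeo G v l b → IncGeo G v l′ b → IncGeo G v (l ⊔ l′) b
  IncGeo-⊔ {v} {l} {l′} {b} γ γ′ with ⊔-sel l l′
  ... | inj₁ eq = subst (λ k → IncGeo G v k b) (sym eq) γ
  ... | inj₂ eq = subst (λ k → IncGeo G v k b) (sym eq) γ′

module Relaxation {n} (G : Subgraph n) where

  Labelling : Set
  Labelling = Vert n → ℕ

  relax : Fin n → Labelling → Labelling
  relax i m v = if inE G v i then m v ⊔ suc (m (flipAt i v)) else m v

  relaxAll : Labelling → List (Fin n) → Labelling
  relaxAll = foldl (λ m i → relax i m)

  Realises : Labelling → ℕ → Set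
  Realises m b = ∀ v → inV G v ≡ true → IncGeo G v (m v) b

  relax-realises : ∀ {m b b′} i → Realises m b → b ≤ toℕ i → toℕ i < b′ →
    Realises (relax i m) b′
  relax-realises {m} {b′ = b′} i R b≤i i<b′ v v∈G with inE G v i in e
  ... | false = IncGeo-weaken (≤-trans b≤i (<⇒≤ i<b′)) (R v v∈G)
  ... | true = IncGeo-⊔ (IncGeo-weaken (≤-trans b≤i (<⇒≤ i<b′)) (R v v∈G))
                 (subst (λ w → IncGeo G w (suc (m u)) b′) (flipAt-involutive i v)
                   (extend i (IncGeo-weaken b≤i (R u (edge-V G u i eᵤ))) eᵤ i<b′))
    where
    u = flipAt i v
    eᵤ : inE G u i ≡ true
    eᵤ = trans (edge-sym G v i) e

  relaxAll-realises : ∀ {k m b} (f : Fin k → Fin n) → (∀ j → toℕ (f j) ≡ b + toℕ j) →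
    Realises m b → Realises (relaxAll m (tabulate f)) (b + k)
  relaxAll-realises {zero} {b = b} f _ R v v∈G = IncGeo-weaken (m≤m+n b 0) (R v v∈G)
  relaxAll-realises {suc k} {b = b} f f≡b+ R v v∈G =
    IncGeo-weaken (≤-reflexive (sym (+-suc b k)))
      (relaxAll-realises (f ∘ fsuc) (λ j → trans (f≡b+ (fsuc j)) (+-suc b (toℕ j)))
        (relax-realises (f fzero) R (≤-reflexive (sym f₀≡b)) (s≤s (≤-reflexive f₀≡b)))
        v v∈G)
    where
    f₀≡b : toℕ (f fzero) ≡ b
    f₀≡b = trans (f≡b+ fzero) (+-identityʳ b)

  weight : Labelling → ℕ
  weight m = sumQ (λ v → if inV G v then m v else 0)

  dirDegree : Fin n → ℕ
  dirDegree i = sumQ (λ v → if inE G v i then 1 else 0)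

  relax-edge : ∀ m i v →
    let w l x = if inV G x then l x else 0
        e = if inE G v i then 1 else 0
    in (e + w m v) + (e + w m (flipAt i v)) ≤ w (relax i m) v + w (relax i m) (flipAt i v)
  relax-edge m i v rewrite edge-sym G v i with inE G v i in e
  ... | false = ≤-refl
  ... | true rewrite edge-V G v i e | edge-V G (flipAt i v) i (trans (edge-sym G v i) e)
                   | flipAt-involutive i v = suc-+-suc≤⊔-+-⊔ (m v) (m (flipAt i v))

  relax-weight : ∀ m i → dirDegree i + weight m ≤ weight (relax i m)
  relax-weight m i = m+m≤n+n⇒m≤n (begin
    (dirDegree i + weight m) + (dirDegree i + weight m)
      ≡⟨ cong (λ s → (dirDegree i + weight m) + (dirDegree i + s)) (sym (sumQ-flipAt i w)) ⟩
    (dirDegree i + weight m) + (dirDegree i + sumQ (w ∘ flipAt i))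
      ≡⟨ sym (cong₂ _+_ (sum-map-+ e w (allVerts n)) (sum-map-+ e (w ∘ flipAt i) (allVerts n))) ⟩
    sumQ (λ v → e v + w v) + sumQ (λ v → e v + w (flipAt i v))
      ≡⟨ sym (sum-map-+ (λ v → e v + w v) (λ v → e v + w (flipAt i v)) (allVerts n)) ⟩
    sumQ (λ v → (e v + w v) + (e v + w (flipAt i v)))
      ≤⟨ sum-map-mono (relax-edge m i) (allVerts n) ⟩
    sumQ (λ v → w′ v + w′ (flipAt i v))
      ≡⟨ sum-map-+ w′ (w′ ∘ flipAt i) (allVerts n) ⟩
    weight (relax i m) + sumQ (w′ ∘ flipAt i)
      ≡⟨ cong (weight (relax i m) +_) (sumQ-flipAt i w′) ⟩
    weight (relax i m) + weight (relax i m) ∎)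
    where
    open ≤-Reasoning
    e w w′ : Vert n → ℕ
    e v = if inE G v i then 1 else 0
    w v = if inV G v then m v else 0
    w′ v = if inV G v then relax i m v else 0

  relaxAll-weight : ∀ m ds → sum (map dirDegree ds) + weight m ≤ weight (relaxAll m ds)
  relaxAll-weight m [] = ≤-refl
  relaxAll-weight m (i ∷ ds) = begin
    (dirDegree i + sum (map dirDegree ds)) + weight m
      ≡⟨ cong (_+ weight m) (+-comm (dirDegree i) _) ⟩
    (sum (map dirDegree ds) + dirDegree i) + weight m
      ≡⟨ +-assoc (sum (map dirDegree ds)) (dirDegree i) (weight m) ⟩
    sum (map dirDegree ds) + (dirDegree i + weight m)
      ≤⟨ +-monoʳ-≤ (sum (map dirDegree ds)) (relax-weight m i) ⟩
    sum (map dirDegree ds) + weight (relax i m)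
      ≤⟨ relaxAll-weight (relax i m) ds ⟩
    weight (relaxAll m (i ∷ ds)) ∎
    where open ≤-Reasoning

  sum-degree≤sum-dirDegree : sum (map (degree G) (verticesOf G)) ≤ sum (map dirDegree (allFin n))
  sum-degree≤sum-dirDegree = begin
    sum (map (degree G) (verticesOf G))
      ≡⟨ sum-map-filter (inV G) (degree G) (allVerts n) ⟩
    sumQ (λ v → if inV G v then degree G v else 0)
      ≤⟨ sum-map-mono if≤ (allVerts n) ⟩
    sumQ (degree G)
      ≡⟨ cong sum (map-cong (λ v → length-filter (inE G v) (allFin n)) (allVerts n)) ⟩
    sumQ (λ v → sum (map (λ i → if inE G v i then 1 else 0) (allFin n)))
      ≡⟨ sum-map-swap (λ v i → if inE G v i then 1 else 0) (allVerts n) (allFin n) ⟩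
    sum (map dirDegree (allFin n)) ∎
    where
    open ≤-Reasoning
    if≤ : ∀ v → (if inV G v then degree G v else 0) ≤ degree G v
    if≤ v with inV G v
    ... | true = ≤-refl
    ... | false = z≤n

  weight≤sum : ∀ {m} (L : Labelling) → (∀ v → inV G v ≡ true → m v ≤ L v) →
    weight m ≤ sum (map L (verticesOf G))
  weight≤sum {m} L m≤L = begin
    weight m                                      ≤⟨ sum-map-mono pointwise (allVerts n) ⟩
    sumQ (λ v → if inV G v then L v else 0)       ≡⟨ sym (sum-map-filter (inV G) L (allVerts n)) ⟩
    sum (map L (verticesOf G))                    ∎
    where
    open ≤-Reasoning
    pointwise : ∀ v → (if inV G v then m v else 0) ≤ (if inV G v then L v else 0)
    pointwise v with inV G v in v∈G
    ... | true = m≤L v v∈G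
    ... | false = z≤n

theorem4 : (n : ℕ) (G : Subgraph n) (L : Vert n → ℕ) →
    (∀ v → inV G v ≡ true → IsMaxIncLen G v (L v)) →
    sum (map (degree G) (verticesOf G)) ≤ sum (map L (verticesOf G))
theorem4 n G L isMax = begin
  sum (map (degree G) (verticesOf G))          ≤⟨ sum-degree≤sum-dirDegree ⟩
  sum (map dirDegree (allFin n))               ≤⟨ m≤m+n _ (weight (λ _ → 0)) ⟩
  sum (map dirDegree (allFin n)) + weight (λ _ → 0)
                                               ≤⟨ relaxAll-weight (λ _ → 0) (allFin n) ⟩
  weight labels                                ≤⟨ weight≤sum L labels≤L ⟩
  sum (map L (verticesOf G))                   ∎
  where
  open ≤-Reasoning
  open Relaxation G
  labels : Labelling
  labels = relaxAll (λ _ → 0) (allFin n)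
  labels≤L : ∀ v → inV G v ≡ true → labels v ≤ L v
  labels≤L v v∈G = proj₂ (isMax v v∈G) (labels v)
    (relaxAll-realises id (λ _ → refl) (λ w w∈G → single w∈G) v v∈G)
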